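{- Let $m=5m'$ with $5\nmid m'$, and assume $11\mid m$. Let $f:\mathbb{Z}_3^3\to\mathbb{Z}_m$ be a function and let $\phi_{m'}:C_m\to C_5$ be the homomorphism defined below, extended linearly to $\mathbb{Z}[C_m]\to\mathbb{Z}[C_5]$. Suppose that for some nonzero $x\in\mathbb{Z}_3^3$ we have $E_x=D_5g^{\alpha_x}+D_{11}(g^{\beta_x}+g^{\gamma_x})$ for some integers $\alpha_x,\beta_x,\gamma_x$. Then $$\phi_{m'}(E_x)=22+D_5=23+u_1+u_1^{ -1}+u_2+u_2^{ -1}$$ in $\mathbb{Z}[C_5]$, where $u_1,u_2\in C_5$ and on the right $D_5=\sum_{c\in C_5}c$.
   Context: $C_k$ denotes the multiplicative cyclic group of order $k$; $g$ is a fixed generator of $C_m$. For $x\in\mathbb{Z}_3^3$, $E_x=\sum_{y\in\mathbb{Z}_3^3}g^{f(x+y)-f(y)}\in\mathbb{Z}[C_m]$. For $d\mid m$, $D_d=\sum_{h\in H_d}h$ where $H_d$ is the unique subgroup of $C_m$ of order $d$. The map $\phi_{m'}$: write $m=\prod_i p_i^{a_i}$ and $m'=\prod_i p_i^{b_i}$ with $0\le b_i\le a_i$; each element of $C_m$ is uniquely a product $\prod_i g_i$ with $\mathrm{ord}(g_i)$ dividing $p_i^{a_i}$ ($g_i$ in the Sylow $p_i$-subgroup), and $\phi_{m'}(\prod_i g_i)=\prod_i g_i^{p_i^{b_i}}$, a homomorphism $C_m\to C_{m/m'}=C_5$. -}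

module Defs where

open import Data.Nat as ℕ using (ℕ; zero; suc)
open import Data.Nat.DivMod using (_mod_; _/_)
open import Data.Integer as ℤ using (ℤ; +_; -_)
open import Data.Integer.Divisibility.Signed using (_∣?_)
open import Data.Fin using (Fin; toℕ; fromℕ)
open import Data.Product using (_×_; _,_)
open import Data.Bool using (if_then_else_)
open import Relation.Nullary using (does)
open import Relation.Binary.PropositionalEquality using (_≡_)

Σ : (n : ℕ) → (Fin n → ℤ) → ℤ
Σ zero    a = + 0
Σ (suc n) a = a Data.Fin.zero ℤ.+ Σ n (λ i → a (Data.Fin.suc i))

Z33 : Set
Z33 = Fin 3 × Fin 3 × Fin 3

_+₃_ : Fin 3 → Fin 3 → Fin 3
a +₃ b = (toℕ a ℕ.+ toℕ b) mod 3

_⊕_ : Z33 → Z33 → Z33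
(a₁ , a₂ , a₃) ⊕ (b₁ , b₂ , b₃) = (a₁ +₃ b₁ , a₂ +₃ b₂ , a₃ +₃ b₃)

zero33 : Z33
zero33 = (Data.Fin.zero , Data.Fin.zero , Data.Fin.zero)

Σ33 : (Z33 → ℤ) → ℤ
Σ33 a = Σ 3 λ i → Σ 3 λ j → Σ 3 λ k → a (i , j , k)

-- Group ring ℤ[C_n]: an element is its coefficient function; index k : Fin n
-- is the coefficient of g^k (g the fixed generator of C_n).
ZG : ℕ → Set
ZG n = Fin n → ℤ

_≈_ : {n : ℕ} → ZG n → ZG n → Set
a ≈ b = ∀ k → a k ≡ b k
infix 4 _≈_

_⊞_ : {n : ℕ} → ZG n → ZG n → ZG n
(a ⊞ b) k = a k ℤ.+ b k
infixl 6 _⊞_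

_⊠_ : {n : ℕ} → ZG n → ZG n → ZG n
_⊠_ {n} a b k =
  Σ n λ i → Σ n λ j →
    if does (+ n ∣? (+ toℕ i ℤ.+ + toℕ j ℤ.- + toℕ k)) then a i ℤ.* b j else + 0
infixl 7 _⊠_

g^ : {n : ℕ} → ℤ → ZG n
g^ {n} a k = if does (+ n ∣? (a ℤ.- + toℕ k)) then + 1 else + 0

ι : {n : ℕ} → ℤ → ZG n
ι {n} z k = z ℤ.* g^ {n} (+ 0) k

ΣG33 : {n : ℕ} → (Z33 → ZG n) → ZG n
ΣG33 F k = Σ33 λ y → F y k

E : (m : ℕ) → (Z33 → Fin m) → Z33 → ZG m
E m f x = ΣG33 λ y → g^ (+ toℕ (f (x ⊕ y)) ℤ.- + toℕ (f y))

-- D_d = Σ_{h ∈ H_d} h, where H_d = {g^{(m/d) j} : 0 ≤ j < d} is the subgroup of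
-- order d of C_m (meaningful when d ∣ m).
D : (m d : ℕ) .{{_ : ℕ.NonZero d}} → ZG m
D m d k = Σ d λ j → g^ (+ ((m / d) ℕ.* toℕ j)) k

-- Sylow decomposition: g^k = g^{m' t} · g^{5 s} with g^{m' t} in the Sylow
-- 5-subgroup (order | 5) and g^{5 s} of order | m'; φ_{m'} keeps the 5-part
-- (raised to 5^0) and kills the rest (raised to p^{a_p}).  Hence
-- φ_{m'}(g^k) = g^{m' t} where t ∈ ℤ_5 is determined by 5 ∣ k - m' t.
-- The target C_5 = Sylow 5-subgroup ⟨g^{m'}⟩ is identified with C_5 via
-- g^{m' t} ↦ u^t (u the generator of C_5); index t : Fin 5 is the coefficient of u^t.
φ : (m' : ℕ) → ZG (5 ℕ.* m') → ZG 5
φ m' a t = Σ (5 ℕ.* m') λ k →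
  if does (+ 5 ∣? (+ toℕ k ℤ.- + (m' ℕ.* toℕ t))) then a k else + 0

-- The coefficient of u^t in φ(E_x) counts the y with
-- d(y) := f(x+y) − f(y) ≡ m't (mod 5); on the other side φ(D₅g^α) = D₅ because m' is a unit
-- mod 5, and φ(D₁₁g^β) = 11·φ(g^β) because 5 divides m/11.  As m't runs through all residues,
-- the residues of the 27 values d(y) are distributed as 1 + 11[v ≡ β] + 11[v ≡ γ].
-- Since 3x = 0, d(y) + d(x+y) + d(2x+y) = 0, so summing a test function G over the triples
-- (y, x+y, 2x+y) writes 3·Σ_v G(v)·#{y : d(y) ≡ v} as a sum of values G(p) + G(q) + G(r) with
-- p + q + r ≡ 0.  Two tests force β ≡ γ ≡ 0 (mod 5): G(v) = v gives β + γ ≡ 0, and if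
-- γ ≡ −β ≢ 0 the weight G = 1 on {±β}, −2 elsewhere is ≤ 0 on every zero-sum triple (none lies
-- inside {±β}) but positive on the distribution, which puts 24 of its 27 points in {±β}.
-- Hence the coefficient of u^t in φ(E_x) is 1 + 22·[m't ≡ 0] = 1 + 22·[t = 0].

module Submission where

open import Defs

module Lemmas where

  open import Algebra.Properties.Semiring.Sum as Sum using ()
  open import Data.Bool using (Bool; true; false; if_then_else_)
  open import Data.Fin using (Fin; zero; suc; toℕ; fromℕ<)
  import Data.Fin.Properties as Finₚ
  open import Data.Integer as ℤ using (ℤ; +_; -_; _+_; _-_; _*_; _≤_; 0ℤ; 1ℤ)
  import Data.Integer.Properties as ℤₚ
  open import Data.Integer.Divisibility.Signed
    using (_∣_; _∣?_; divides; ∣-trans; ∣m∣n⇒∣m+n; ∣m∣n⇒∣m-n; ∣m⇒∣-m; ∣n⇒∣m*n; ∣⇒∣ᵤ; ∣ᵤ⇒∣)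
  open import Data.Integer.DivMod using (_%ℕ_; _/ℕ_; n%ℕd<d; a≡a%ℕn+[a/ℕn]*n)
  open import Data.Integer.Tactic.RingSolver using (solve-∀)
  open import Data.Nat as ℕ using (ℕ; zero; suc)
  import Data.Nat.Properties as ℕₚ
  import Data.Nat.Divisibility as ℕ∣
  import Data.Nat.DivMod as ℕ/
  open import Data.Nat.Coprimality using (coprime?; coprime-divisor)
  open import Data.Product using (∃-syntax; Σ-syntax; _×_; _,_; proj₁; proj₂)
  open import Function using (_∘_)
  open import Function.Bundles using (mk⇔)
  open import Level using (0ℓ)
  open import Relation.Binary.Bundles using (Setoid)
  import Relation.Binary.Reasoning.Setoid
  open import Relation.Nullary using (does; ¬_; Dec; contradiction)
  open import Relation.Nullary.Decidable using (does-⇔; from-yes; map′; ¬?; _→-dec_; _×-dec_)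
  open import Relation.Binary.PropositionalEquality
    using (_≡_; _≢_; refl; sym; trans; cong; cong₂; subst; subst₂; module ≡-Reasoning)

  -- Finite sums

  private
    module ΣZ = Sum ℤₚ.+-*-semiring

  Σ≗sum : ∀ n (a : Fin n → ℤ) → Σ n a ≡ ΣZ.sum a
  Σ≗sum zero    a = refl
  Σ≗sum (suc n) a = cong (_+_ (a zero)) (Σ≗sum n (a ∘ suc))

  Σ-cong : ∀ n {a b : Fin n → ℤ} → (∀ i → a i ≡ b i) → Σ n a ≡ Σ n b
  Σ-cong n {a} {b} a≗b = begin
    Σ n a      ≡⟨ Σ≗sum n a ⟩
    ΣZ.sum a   ≡⟨ ΣZ.sum-cong-≗ a≗b ⟩
    ΣZ.sum b   ≡⟨ Σ≗sum n b ⟨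
    Σ n b      ∎
    where open ≡-Reasoning

  Σ-distrib-+ : ∀ n (a b : Fin n → ℤ) → Σ n (λ i → a i + b i) ≡ Σ n a + Σ n b
  Σ-distrib-+ n a b = begin
    Σ n (λ i → a i + b i)       ≡⟨ Σ≗sum n _ ⟩
    ΣZ.sum (λ i → a i + b i)    ≡⟨ ΣZ.∑-distrib-+ a b ⟩
    ΣZ.sum a + ΣZ.sum b         ≡⟨ cong₂ _+_ (Σ≗sum n a) (Σ≗sum n b) ⟨
    Σ n a + Σ n b               ∎
    where open ≡-Reasoning

  Σ-comm : ∀ m n (a : Fin m → Fin n → ℤ) →
           Σ m (λ i → Σ n (a i)) ≡ Σ n (λ j → Σ m (λ i → a i j))
  Σ-comm m n a = begin
    Σ m (λ i → Σ n (a i))                      ≡⟨ Σ-cong m (λ i → Σ≗sum n (a i)) ⟩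
    Σ m (λ i → ΣZ.sum (a i))                   ≡⟨ Σ≗sum m _ ⟩
    ΣZ.sum (λ i → ΣZ.sum (a i))                ≡⟨ ΣZ.∑-comm a ⟩
    ΣZ.sum (λ j → ΣZ.sum (λ i → a i j))        ≡⟨ Σ≗sum n _ ⟨
    Σ n (λ j → ΣZ.sum (λ i → a i j))           ≡⟨ Σ-cong n (λ j → Σ≗sum m (λ i → a i j)) ⟨
    Σ n (λ j → Σ m (λ i → a i j))              ∎
    where open ≡-Reasoning

  *-distribˡ-Σ : ∀ n c (a : Fin n → ℤ) → c * Σ n a ≡ Σ n (λ i → c * a i)
  *-distribˡ-Σ n c a = begin
    c * Σ n a                  ≡⟨ cong (c *_) (Σ≗sum n a) ⟩
    c * ΣZ.sum a               ≡⟨ ΣZ.*-distribˡ-sum c a ⟩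
    ΣZ.sum (λ i → c * a i)     ≡⟨ Σ≗sum n _ ⟨
    Σ n (λ i → c * a i)        ∎
    where open ≡-Reasoning

  Σ-const : ∀ n c → Σ n (λ _ → c) ≡ + n * c
  Σ-const zero    c = sym (ℤₚ.*-zeroˡ c)
  Σ-const (suc n) c = begin
    c + Σ n (λ _ → c)     ≡⟨ cong (_+_ c) (Σ-const n c) ⟩
    c + + n * c         ≡⟨ cong (_+ + n * c) (ℤₚ.*-identityˡ c) ⟨
    1ℤ * c + + n * c    ≡⟨ ℤₚ.*-distribʳ-+ c 1ℤ (+ n) ⟨
    + suc n * c           ∎
    where open ≡-Reasoning

  Σ-zero : ∀ n → Σ n (λ _ → 0ℤ) ≡ 0ℤ
  Σ-zero n = trans (Σ-const n 0ℤ) (ℤₚ.*-zeroʳ (+ n))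

  if-distrib-+ : ∀ b x y → (if b then x + y else 0ℤ) ≡ (if b then x else 0ℤ) + (if b then y else 0ℤ)
  if-distrib-+ true  x y = refl
  if-distrib-+ false x y = refl

  if-distrib-Σ : ∀ b n (a : Fin n → ℤ) → (if b then Σ n a else 0ℤ) ≡ Σ n (λ i → if b then a i else 0ℤ)
  if-distrib-Σ true  n a = refl
  if-distrib-Σ false n a = sym (Σ-zero n)

  if-comm : ∀ b c x →
            (if b then (if c then x else 0ℤ) else 0ℤ) ≡ (if c then (if b then x else 0ℤ) else 0ℤ)
  if-comm true  true  x = refl
  if-comm true  false x = refl
  if-comm false true  x = refl
  if-comm false false x = refl

  *-indicator : ∀ b x → x * (if b then 1ℤ else 0ℤ) ≡ (if b then x else 0ℤ)
  *-indicator true  x = ℤₚ.*-identityʳ x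
  *-indicator false x = ℤₚ.*-zeroʳ x

  Σ33-cong : ∀ {a b : Z33 → ℤ} → (∀ y → a y ≡ b y) → Σ33 a ≡ Σ33 b
  Σ33-cong a≗b = Σ-cong 3 λ i → Σ-cong 3 λ j → Σ-cong 3 λ k → a≗b (i , j , k)

  Σ33-distrib-+ : ∀ (a b : Z33 → ℤ) → Σ33 (λ y → a y + b y) ≡ Σ33 a + Σ33 b
  Σ33-distrib-+ a b =
    trans (Σ-cong 3 λ i → trans (Σ-cong 3 λ j → Σ-distrib-+ 3 (a₃ i j) (b₃ i j))
                                (Σ-distrib-+ 3 (λ j → Σ 3 (a₃ i j)) (λ j → Σ 3 (b₃ i j))))
          (Σ-distrib-+ 3 (λ i → Σ 3 λ j → Σ 3 (a₃ i j)) (λ i → Σ 3 λ j → Σ 3 (b₃ i j)))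
    where
    a₃ b₃ : Fin 3 → Fin 3 → Fin 3 → ℤ
    a₃ i j k = a (i , j , k)
    b₃ i j k = b (i , j , k)

  Σ33-comm : ∀ n (a : Z33 → Fin n → ℤ) → Σ33 (λ y → Σ n (a y)) ≡ Σ n (λ v → Σ33 (λ y → a y v))
  Σ33-comm n a =
    trans (Σ-cong 3 λ i → trans (Σ-cong 3 λ j → Σ-comm 3 n (λ k → a (i , j , k)))
                                (Σ-comm 3 n (λ j v → Σ 3 λ k → a (i , j , k) v)))
          (Σ-comm 3 n (λ i v → Σ 3 λ j → Σ 3 λ k → a (i , j , k) v))

  *-distribˡ-Σ33 : ∀ c (a : Z33 → ℤ) → c * Σ33 a ≡ Σ33 (λ y → c * a y)
  *-distribˡ-Σ33 c a =
    trans (*-distribˡ-Σ 3 c (λ i → Σ 3 λ j → Σ 3 λ k → a (i , j , k))) (Σ-cong 3 λ i →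
    trans (*-distribˡ-Σ 3 c (λ j → Σ 3 λ k → a (i , j , k))) (Σ-cong 3 λ j →
           *-distribˡ-Σ 3 c (λ k → a (i , j , k))))

  Σ3-translate : ∀ c (a : Fin 3 → ℤ) → Σ 3 (λ i → a (c +₃ i)) ≡ Σ 3 a
  Σ3-translate zero                a = refl
  Σ3-translate (suc zero)          a = rotate (a zero) (a (suc zero)) (a (suc (suc zero)))
    where
    rotate : ∀ a₀ a₁ a₂ → a₁ + (a₂ + (a₀ + 0ℤ)) ≡ a₀ + (a₁ + (a₂ + 0ℤ))
    rotate = solve-∀
  Σ3-translate (suc (suc zero))    a = rotate (a zero) (a (suc zero)) (a (suc (suc zero)))
    where
    rotate : ∀ a₀ a₁ a₂ → a₂ + (a₀ + (a₁ + 0ℤ)) ≡ a₀ + (a₁ + (a₂ + 0ℤ))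
    rotate = solve-∀

  Σ33-translate : ∀ x (a : Z33 → ℤ) → Σ33 (λ y → a (x ⊕ y)) ≡ Σ33 a
  Σ33-translate (x₁ , x₂ , x₃) a =
    trans (Σ-cong 3 λ i → trans (Σ-cong 3 λ j → Σ3-translate x₃ (λ k → a (x₁ +₃ i , x₂ +₃ j , k)))
                                (Σ3-translate x₂ (λ j → Σ 3 λ k → a (x₁ +₃ i , j , k))))
          (Σ3-translate x₁ (λ i → Σ 3 λ j → Σ 3 λ k → a (i , j , k)))

  +₃-cube : ∀ a b → a +₃ (a +₃ (a +₃ b)) ≡ b
  +₃-cube = from-yes (Finₚ.all? λ a → Finₚ.all? λ b → a +₃ (a +₃ (a +₃ b)) Finₚ.≟ b)

  ⊕-cube : ∀ x y → x ⊕ (x ⊕ (x ⊕ y)) ≡ y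
  ⊕-cube (x₁ , x₂ , x₃) (y₁ , y₂ , y₃) =
    cong₂ _,_ (+₃-cube x₁ y₁) (cong₂ _,_ (+₃-cube x₂ y₂) (+₃-cube x₃ y₃))

  record AdditivelyClosed (P : ℤ → Set) : Set where
    field
      closed-0 : P 0ℤ
      closed-+ : ∀ {a b} → P a → P b → P (a + b)

  module _ {P : ℤ → Set} (closed : AdditivelyClosed P) where
    open AdditivelyClosed closed

    Σ-closed : ∀ n {a : Fin n → ℤ} → (∀ i → P (a i)) → P (Σ n a)
    Σ-closed zero    _  = closed-0
    Σ-closed (suc n) Pa = closed-+ (Pa zero) (Σ-closed n (Pa ∘ suc))

    Σ33-closed : ∀ {a : Z33 → ℤ} → (∀ y → P (a y)) → P (Σ33 a)
    Σ33-closed Pa = Σ-closed 3 λ i → Σ-closed 3 λ j → Σ-closed 3 λ k → Pa (i , j , k)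

  -- Congruences and residues

  -- A record rather than an abbreviation of + n ∣ a - b, so that a and b stay inferable.
  infix 4 _≡_mod_
  record _≡_mod_ (a b : ℤ) (n : ℕ) : Set where
    constructor ≡-mod
    field ∣-difference : + n ∣ a - b
  open _≡_mod_

  module _ {n : ℕ} where

    mod-refl : ∀ {a} → a ≡ a mod n
    mod-refl {a} = ≡-mod (subst (+ n ∣_) (sym (ℤₚ.+-inverseʳ a)) (divides 0ℤ refl))

    mod-sym : ∀ {a b} → a ≡ b mod n → b ≡ a mod n
    mod-sym {a} {b} (≡-mod p) = ≡-mod (subst (+ n ∣_) (identity a b) (∣m⇒∣-m p))
      where
      identity : ∀ a b → - (a - b) ≡ b - a
      identity = solve-∀

    mod-trans : ∀ {a b c} → a ≡ b mod n → b ≡ c mod n → a ≡ c mod n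
    mod-trans {a} {b} {c} (≡-mod p) (≡-mod q) = ≡-mod (subst (+ n ∣_) (identity a b c) (∣m∣n⇒∣m+n p q))
      where
      identity : ∀ a b c → a - b + (b - c) ≡ a - c
      identity = solve-∀

    mod-+-cong : ∀ {a b c d} → a ≡ b mod n → c ≡ d mod n → a + c ≡ b + d mod n
    mod-+-cong {a} {b} {c} {d} (≡-mod p) (≡-mod q) =
      ≡-mod (subst (+ n ∣_) (identity a b c d) (∣m∣n⇒∣m+n p q))
      where
      identity : ∀ a b c d → a - b + (c - d) ≡ a + c - (b + d)
      identity = solve-∀

    mod-+-congʳ : ∀ c {a b} → a ≡ b mod n → a + c ≡ b + c mod n
    mod-+-congʳ c p = mod-+-cong p (mod-refl {c})

    mod-+-congˡ : ∀ c {a b} → a ≡ b mod n → c + a ≡ c + b mod n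
    mod-+-congˡ c p = mod-+-cong (mod-refl {c}) p

    mod-neg-cong : ∀ {a b} → a ≡ b mod n → - a ≡ - b mod n
    mod-neg-cong {a} {b} (≡-mod p) = ≡-mod (subst (+ n ∣_) (identity a b) (∣m⇒∣-m p))
      where
      identity : ∀ a b → - (a - b) ≡ - a - - b
      identity = solve-∀

    mod-*-congˡ : ∀ c {a b} → a ≡ b mod n → c * a ≡ c * b mod n
    mod-*-congˡ c {a} {b} (≡-mod p) = ≡-mod (subst (+ n ∣_) (identity c a b) (∣n⇒∣m*n c p))
      where
      identity : ∀ c a b → c * (a - b) ≡ c * a - c * b
      identity = solve-∀

    mod-*-congʳ : ∀ c {a b} → a ≡ b mod n → a * c ≡ b * c mod n
    mod-*-congʳ c {a} {b} p =
      subst₂ (λ x y → x ≡ y mod n) (ℤₚ.*-comm c a) (ℤₚ.*-comm c b) (mod-*-congˡ c p)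

    ≡⇒≡-mod : ∀ {a b} → a ≡ b → a ≡ b mod n
    ≡⇒≡-mod refl = mod-refl

    ∣⇒≡0-mod : ∀ {a} → + n ∣ a → a ≡ 0ℤ mod n
    ∣⇒≡0-mod {a} = ≡-mod ∘ subst (+ n ∣_) (sym (ℤₚ.+-identityʳ a))

    mod-setoid : Setoid 0ℓ 0ℓ
    mod-setoid = record
      { Carrier = ℤ
      ; _≈_ = (λ a b → a ≡ b mod n)
      ; isEquivalence = record { refl = mod-refl ; sym = mod-sym ; trans = mod-trans }
      }

  module mod-Reasoning (n : ℕ) = Relation.Binary.Reasoning.Setoid (mod-setoid {n})

  mod-weaken : ∀ {d n a b} → + d ∣ + n → a ≡ b mod n → a ≡ b mod d
  mod-weaken d∣n (≡-mod n∣a-b) = ≡-mod (∣-trans d∣n n∣a-b)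

  infix 4 _≡?_mod_
  _≡?_mod_ : ∀ a b n → Dec (a ≡ b mod n)
  a ≡? b mod n = map′ ≡-mod ∣-difference (+ n ∣? (a - b))

  ∣-resp-≡-mod : ∀ {n a b} → a ≡ b mod n → + n ∣ a → + n ∣ b
  ∣-resp-≡-mod {n} {a} {b} (≡-mod p) n∣a = subst (+ n ∣_) (identity a b) (∣m∣n⇒∣m-n n∣a p)
    where
    identity : ∀ a b → a - (a - b) ≡ b
    identity = solve-∀

  ∣?-cong : ∀ {n a b} → a ≡ b mod n → does (+ n ∣? a) ≡ does (+ n ∣? b)
  ∣?-cong {n} {a} {b} a≡b =
    does-⇔ (mk⇔ (∣-resp-≡-mod a≡b) (∣-resp-≡-mod (mod-sym a≡b))) (+ n ∣? a) (+ n ∣? b)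

  -- g^ {n} a k unfolds to [ n ∣ a - + toℕ k ].
  [_∣_] : ℕ → ℤ → ℤ
  [ n ∣ z ] = if does (+ n ∣? z) then 1ℤ else 0ℤ

  [∣]-cong : ∀ {n a b} → a ≡ b mod n → [ n ∣ a ] ≡ [ n ∣ b ]
  [∣]-cong a≡b = cong (if_then 1ℤ else 0ℤ) (∣?-cong a≡b)

  [∣]-neg : ∀ n a → [ n ∣ - a ] ≡ [ n ∣ a ]
  [∣]-neg n a = cong (if_then 1ℤ else 0ℤ)
    (does-⇔ (mk⇔ (subst (+ n ∣_) (ℤₚ.neg-involutive a) ∘ ∣m⇒∣-m) ∣m⇒∣-m) (+ n ∣? (- a)) (+ n ∣? a))

  module _ (n : ℕ) .{{_ : ℕ.NonZero n}} where

    residue : ℤ → Fin n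
    residue a = fromℕ< (n%ℕd<d a n)

    residue-correct : ∀ a → a ≡ + toℕ (residue a) mod n
    residue-correct a = ≡-mod (divides (a /ℕ n) (begin
      a - + toℕ (residue a)                    ≡⟨ cong (λ r → a - + r) (Finₚ.toℕ-fromℕ< (n%ℕd<d a n)) ⟩
      a - + (a %ℕ n)                           ≡⟨ cong (_- + (a %ℕ n)) (a≡a%ℕn+[a/ℕn]*n a n) ⟩
      + (a %ℕ n) + a /ℕ n * + n - + (a %ℕ n)   ≡⟨ identity (+ (a %ℕ n)) (a /ℕ n * + n) ⟩
      a /ℕ n * + n                             ∎))
      where
      open ≡-Reasoning
      identity : ∀ r q → r + q - r ≡ q
      identity = solve-∀

  toℕ-mod-injective : ∀ {n} (i j : Fin n) → + toℕ i ≡ + toℕ j mod n → i ≡ j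
  toℕ-mod-injective {n} i j (≡-mod n∣i-j) = Finₚ.toℕ-injective (ℤₚ.+-injective (ℤₚ.i-j≡0⇒i≡j _ _ i-j≡0))
    where
    instance
      n≢0 : ℕ.NonZero n
      n≢0 = ℕ.>-nonZero (ℕₚ.≤-<-trans ℕ.z≤n (Finₚ.toℕ<n i))
    ∣i-j∣<n : ℤ.∣ + toℕ i - + toℕ j ∣ ℕ.< n
    ∣i-j∣<n = begin-strict
      ℤ.∣ + toℕ i - + toℕ j ∣     ≡⟨ cong ℤ.∣_∣ (ℤₚ.[+m]-[+n]≡m⊖n (toℕ i) (toℕ j)) ⟩
      ℤ.∣ toℕ i ℤ.⊖ toℕ j ∣       ≤⟨ ℤₚ.∣m⊝n∣≤m⊔n (toℕ i) (toℕ j) ⟩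
      toℕ i ℕ.⊔ toℕ j             <⟨ ℕₚ.⊔-lub (Finₚ.toℕ<n i) (Finₚ.toℕ<n j) ⟩
      n                           ∎
      where open ℕₚ.≤-Reasoning
    i-j≡0 : + toℕ i - + toℕ j ≡ 0ℤ
    i-j≡0 = ℤₚ.∣i∣≡0⇒i≡0 (trans (sym (ℕ/.m<n⇒m%n≡m ∣i-j∣<n)) (ℕ∣.n∣m⇒m%n≡0 _ n (∣⇒∣ᵤ n∣i-j)))

  residue-unique : ∀ {n} .{{_ : ℕ.NonZero n}} a (k : Fin n) → a ≡ + toℕ k mod n → residue n a ≡ k
  residue-unique {n} a k a≡k = toℕ-mod-injective _ k (mod-trans (mod-sym (residue-correct n a)) a≡k)

  Σ-at : ∀ n (k₀ : Fin n) (h : Fin n → ℤ) → Σ n (λ k → if does (k Finₚ.≟ k₀) then h k else 0ℤ) ≡ h k₀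
  Σ-at (suc n) zero     h = trans (cong (_+_ (h zero)) (Σ-zero n)) (ℤₚ.+-identityʳ (h zero))
  Σ-at (suc n) (suc k₀) h = trans (ℤₚ.+-identityˡ _) (Σ-at n k₀ (h ∘ suc))

  Σ-at-residue : ∀ n .{{_ : ℕ.NonZero n}} a (h : Fin n → ℤ) →
                 Σ n (λ k → if does (+ n ∣? (a - + toℕ k)) then h k else 0ℤ) ≡ h (residue n a)
  Σ-at-residue n a h = begin
    Σ n (λ k → if does (+ n ∣? (a - + toℕ k)) then h k else 0ℤ)
      ≡⟨ Σ-cong n (λ k → cong (if_then h k else 0ℤ)
                    (does-⇔ (mk⇔ (only k) (hit k)) (+ n ∣? (a - + toℕ k)) (k Finₚ.≟ residue n a))) ⟩
    Σ n (λ k → if does (k Finₚ.≟ residue n a) then h k else 0ℤ)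
      ≡⟨ Σ-at n (residue n a) h ⟩
    h (residue n a) ∎
    where
    open ≡-Reasoning
    only : ∀ k → + n ∣ a - + toℕ k → k ≡ residue n a
    only k n∣a-k = sym (residue-unique a k (≡-mod n∣a-k))
    hit : ∀ k → k ≡ residue n a → + n ∣ a - + toℕ k
    hit k refl = ∣-difference (residue-correct n a)

  module _ {n : ℕ} (u r : ℤ) (ur≡1 : u * r ≡ 1ℤ mod n) where

    *-unit-inverse : ∀ w → w * (u * r) ≡ w mod n
    *-unit-inverse w = mod-trans (mod-*-congˡ w ur≡1) (≡⇒≡-mod (ℤₚ.*-identityʳ w))

    [∣]-unit : ∀ w → [ n ∣ u * w ] ≡ [ n ∣ w ]
    [∣]-unit w = cong (if_then 1ℤ else 0ℤ)
      (does-⇔ (mk⇔ (∣-resp-≡-mod r*u*w≡w ∘ ∣n⇒∣m*n r) (∣n⇒∣m*n u)) (+ n ∣? (u * w)) (+ n ∣? w))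
      where
      r*u*w≡w : r * (u * w) ≡ w mod n
      r*u*w≡w = mod-trans (≡⇒≡-mod (reassoc r u w)) (*-unit-inverse w)
        where
        reassoc : ∀ r u w → r * (u * w) ≡ w * (u * r)
        reassoc = solve-∀

    unit-surjective : .{{_ : ℕ.NonZero n}} → ∀ v → ∃[ t ] (u * + toℕ t ≡ v mod n)
    unit-surjective v = residue n (r * v) , (begin
      u * + toℕ (residue n (r * v))   ≈⟨ mod-*-congˡ u (mod-sym (residue-correct n (r * v))) ⟩
      u * (r * v)                     ≡⟨ reassoc u r v ⟩
      v * (u * r)                     ≈⟨ *-unit-inverse v ⟩
      v                               ∎)
      where
      open mod-Reasoning n
      reassoc : ∀ u r v → u * (r * v) ≡ v * (u * r)
      reassoc = solve-∀

    Σ-unit : .{{_ : ℕ.NonZero n}} → ∀ z → Σ n (λ l → [ n ∣ u * + toℕ l + z ]) ≡ 1ℤ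
    Σ-unit z = begin
      Σ n (λ l → [ n ∣ u * + toℕ l + z ])       ≡⟨ Σ-cong n (λ l → [∣]-cong (factor l)) ⟩
      Σ n (λ l → [ n ∣ u * (+ toℕ l + r * z) ]) ≡⟨ Σ-cong n (λ l → [∣]-unit (+ toℕ l + r * z)) ⟩
      Σ n (λ l → [ n ∣ + toℕ l + r * z ])
        ≡⟨ Σ-cong n (λ l → trans (cong [ n ∣_] (negate l)) ([∣]-neg n (+ toℕ l + r * z))) ⟨
      Σ n (λ l → [ n ∣ - (r * z) - + toℕ l ])   ≡⟨ Σ-at-residue n (- (r * z)) (λ _ → 1ℤ) ⟩
      1ℤ                                        ∎
      where
      open ≡-Reasoning
      negate : ∀ l → - (r * z) - + toℕ l ≡ - (+ toℕ l + r * z)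
      negate l = identity (r * z) (+ toℕ l)
        where
        identity : ∀ a b → - a - b ≡ - (b + a)
        identity = solve-∀
      factor : ∀ l → u * + toℕ l + z ≡ u * (+ toℕ l + r * z) mod n
      factor l = mod-trans (mod-+-congˡ (u * + toℕ l) (mod-sym (*-unit-inverse z)))
                           (≡⇒≡-mod (identity u r z (+ toℕ l)))
        where
        identity : ∀ u r z l → u * l + z * (u * r) ≡ u * (l + r * z)
        identity = solve-∀

  residue-inverse : ∀ (ρ : Fin 5) → ρ ≢ zero → Σ[ r ∈ Fin 5 ] (+ toℕ ρ * + toℕ r ≡ 1ℤ mod 5)
  residue-inverse = from-yes
    (Finₚ.all? λ (ρ : Fin 5) → ¬? (ρ Finₚ.≟ zero) →-dec
     Finₚ.any? λ (r : Fin 5) → + toℕ ρ * + toℕ r ≡? 1ℤ mod 5)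

  inverse-mod-5 : ∀ m' → ¬ 5 ℕ∣.∣ m' → ∃[ r ] (+ m' * r ≡ 1ℤ mod 5)
  inverse-mod-5 m' 5∤m' =
    let r , ρr≡1 = residue-inverse ρ ρ≢0
    in  + toℕ r , mod-trans (mod-*-congʳ (+ toℕ r) (residue-correct 5 (+ m'))) ρr≡1
    where
    ρ : Fin 5
    ρ = residue 5 (+ m')
    ρ≢0 : ρ ≢ zero
    ρ≢0 ρ≡0 = 5∤m' (subst (5 ℕ∣.∣_) (ℕₚ.+-identityʳ m')
      (∣⇒∣ᵤ (∣-difference (subst (λ k → + m' ≡ + toℕ k mod 5) ρ≡0 (residue-correct 5 (+ m'))))))

  -- The group ring ℤ[C_n] and φ_{m'}

  module _ {n : ℕ} .{{_ : ℕ.NonZero n}} where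

    ⊠-g^ : ∀ (A : ZG n) a k →
           (A ⊠ g^ a) k ≡ Σ n (λ i → if does (+ n ∣? (+ toℕ i + a - + toℕ k)) then A i else 0ℤ)
    ⊠-g^ A a k = begin
      (A ⊠ g^ a) k
        ≡⟨ Σ-cong n (λ i → Σ-cong n (λ j → trans (cong (if P i j then_else 0ℤ) (*-indicator (Q j) (A i)))
                                                  (if-comm (P i j) (Q j) (A i)))) ⟩
      Σ n (λ i → Σ n (λ j → if Q j then (if P i j then A i else 0ℤ) else 0ℤ))
        ≡⟨ Σ-cong n (λ i → Σ-at-residue n a (λ j → if P i j then A i else 0ℤ)) ⟩
      Σ n (λ i → if P i (residue n a) then A i else 0ℤ)
        ≡⟨ Σ-cong n (λ i → cong (if_then A i else 0ℤ) (∣?-cong (shift i))) ⟩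
      Σ n (λ i → if does (+ n ∣? (+ toℕ i + a - + toℕ k)) then A i else 0ℤ) ∎
      where
      open ≡-Reasoning
      P : Fin n → Fin n → Bool
      P i j = does (+ n ∣? (+ toℕ i + + toℕ j - + toℕ k))
      Q : Fin n → Bool
      Q j = does (+ n ∣? (a - + toℕ j))
      shift : ∀ i → + toℕ i + + toℕ (residue n a) - + toℕ k ≡ + toℕ i + a - + toℕ k mod n
      shift i = mod-+-congʳ (- + toℕ k) (mod-+-congˡ (+ toℕ i) (mod-sym (residue-correct n a)))

    g^-⊠-g^ : ∀ b a → g^ b ⊠ g^ a ≈ g^ {n} (b + a)
    g^-⊠-g^ b a k = begin
      (g^ b ⊠ g^ a) k
        ≡⟨ ⊠-g^ (g^ b) a k ⟩
      Σ n (λ i → if R i then g^ b i else 0ℤ)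
        ≡⟨ Σ-cong n (λ i → if-comm (R i) _ 1ℤ) ⟩
      Σ n (λ i → if does (+ n ∣? (b - + toℕ i)) then (if R i then 1ℤ else 0ℤ) else 0ℤ)
        ≡⟨ Σ-at-residue n b (λ i → if R i then 1ℤ else 0ℤ) ⟩
      (if R (residue n b) then 1ℤ else 0ℤ)
        ≡⟨ [∣]-cong (mod-+-congʳ (- + toℕ k) (mod-+-congʳ a (mod-sym (residue-correct n b)))) ⟩
      g^ (b + a) k ∎
      where
      open ≡-Reasoning
      R : Fin n → Bool
      R i = does (+ n ∣? (+ toℕ i + a - + toℕ k))

    Σ-⊠-g^ : ∀ d (F : Fin d → ZG n) a k →
             ((λ i → Σ d (λ l → F l i)) ⊠ g^ a) k ≡ Σ d (λ l → (F l ⊠ g^ a) k)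
    Σ-⊠-g^ d F a k = begin
      ((λ i → Σ d (λ l → F l i)) ⊠ g^ a) k       ≡⟨ ⊠-g^ _ a k ⟩
      Σ n (λ i → if R i then Σ d (λ l → F l i) else 0ℤ)
        ≡⟨ Σ-cong n (λ i → if-distrib-Σ (R i) d (λ l → F l i)) ⟩
      Σ n (λ i → Σ d (λ l → if R i then F l i else 0ℤ))
        ≡⟨ Σ-comm n d _ ⟩
      Σ d (λ l → Σ n (λ i → if R i then F l i else 0ℤ))
        ≡⟨ Σ-cong d (λ l → ⊠-g^ (F l) a k) ⟨
      Σ d (λ l → (F l ⊠ g^ a) k)                   ∎
      where
      open ≡-Reasoning
      R : Fin n → Bool
      R i = does (+ n ∣? (+ toℕ i + a - + toℕ k))

    D-⊠-g^ : ∀ d .{{_ : ℕ.NonZero d}} a →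
             D n d ⊠ g^ a ≈ (λ k → Σ d (λ l → g^ (+ (n ℕ./ d ℕ.* toℕ l) + a) k))
    D-⊠-g^ d a k = trans (Σ-⊠-g^ d (λ l → g^ (+ (n ℕ./ d ℕ.* toℕ l))) a k)
                         (Σ-cong d (λ l → g^-⊠-g^ (+ (n ℕ./ d ℕ.* toℕ l)) a k))

  ⊠-distribˡ-⊞ : ∀ {n} (A b c : ZG n) → A ⊠ (b ⊞ c) ≈ A ⊠ b ⊞ A ⊠ c
  ⊠-distribˡ-⊞ {n} A b c k = begin
    (A ⊠ (b ⊞ c)) k
      ≡⟨ Σ-cong n (λ i → Σ-cong n (λ j → trans (cong (if P i j then_else 0ℤ) (ℤₚ.*-distribˡ-+ (A i) _ _))
                                                (if-distrib-+ (P i j) _ _))) ⟩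
    Σ n (λ i → Σ n (λ j → term b i j + term c i j))
      ≡⟨ Σ-cong n (λ i → Σ-distrib-+ n (term b i) (term c i)) ⟩
    Σ n (λ i → Σ n (term b i) + Σ n (term c i))
      ≡⟨ Σ-distrib-+ n _ _ ⟩
    (A ⊠ b) k + (A ⊠ c) k ∎
    where
    open ≡-Reasoning
    P : Fin n → Fin n → Bool
    P i j = does (+ n ∣? (+ toℕ i + + toℕ j - + toℕ k))
    term : ZG n → Fin n → Fin n → ℤ
    term e i j = if P i j then A i * e j else 0ℤ

  module _ (m' : ℕ) where

    private
      m = 5 ℕ.* m'
      Q : Fin 5 → Fin m → Bool
      Q t k = does (+ 5 ∣? (+ toℕ k - + (m' ℕ.* toℕ t)))

    φ-cong : ∀ {a b : ZG m} → a ≈ b → φ m' a ≈ φ m' b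
    φ-cong a≈b t = Σ-cong m (λ k → cong (if Q t k then_else 0ℤ) (a≈b k))

    φ-⊞ : ∀ (a b : ZG m) → φ m' (a ⊞ b) ≈ φ m' a ⊞ φ m' b
    φ-⊞ a b t = trans (Σ-cong m (λ k → if-distrib-+ (Q t k) (a k) (b k))) (Σ-distrib-+ m _ _)

    φ-Σ : ∀ d (F : Fin d → ZG m) t → φ m' (λ k → Σ d (λ l → F l k)) t ≡ Σ d (λ l → φ m' (F l) t)
    φ-Σ d F t = trans (Σ-cong m (λ k → if-distrib-Σ (Q t k) d (λ l → F l k))) (Σ-comm m d _)

    φ-ΣG33 : ∀ (F : Z33 → ZG m) t → φ m' (ΣG33 F) t ≡ Σ33 (λ y → φ m' (F y) t)
    φ-ΣG33 F t =
      trans (φ-Σ 3 (λ i k → Σ 3 λ j → Σ 3 λ l → F (i , j , l) k) t) (Σ-cong 3 λ i →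
      trans (φ-Σ 3 (λ j k → Σ 3 λ l → F (i , j , l) k) t) (Σ-cong 3 λ j →
             φ-Σ 3 (λ l → F (i , j , l)) t))

    φ-g^ : .{{_ : ℕ.NonZero m}} → ∀ a t → φ m' (g^ a) t ≡ [ 5 ∣ a - + (m' ℕ.* toℕ t) ]
    φ-g^ a t = begin
      φ m' (g^ a) t
        ≡⟨ Σ-cong m (λ k → if-comm (Q t k) _ 1ℤ) ⟩
      Σ m (λ k → if does (+ m ∣? (a - + toℕ k)) then (if Q t k then 1ℤ else 0ℤ) else 0ℤ)
        ≡⟨ Σ-at-residue m a (λ k → if Q t k then 1ℤ else 0ℤ) ⟩
      [ 5 ∣ + toℕ (residue m a) - + (m' ℕ.* toℕ t) ]
        ≡⟨ [∣]-cong (mod-+-congʳ (- + (m' ℕ.* toℕ t)) (mod-weaken 5∣m (mod-sym (residue-correct m a)))) ⟩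
      [ 5 ∣ a - + (m' ℕ.* toℕ t) ] ∎
      where
      open ≡-Reasoning
      5∣m : + 5 ∣ + m
      5∣m = ∣ᵤ⇒∣ (ℕ∣.m∣m*n m')

  -- Counting residues along zero-sum triples

  count : ℕ → (Z33 → ℤ) → ℤ → ℤ
  count n d v = Σ33 (λ y → [ n ∣ d y - v ])

  count-cong : ∀ n d {v w} → v ≡ w mod n → count n d v ≡ count n d w
  count-cong n d v≡w = Σ33-cong λ y → [∣]-cong (mod-+-congˡ (d y) (mod-neg-cong v≡w))

  ZeroSumAlong : Z33 → (Z33 → ℤ) → Set
  ZeroSumAlong x d = ∀ y → d y + d (x ⊕ y) + d (x ⊕ (x ⊕ y)) ≡ 0ℤ

  module _ (n : ℕ) .{{_ : ℕ.NonZero n}} (x : Z33) (d : Z33 → ℤ) (zero-sum : ZeroSumAlong x d) where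

    Σ-weighted-count : ∀ (G : Fin n → ℤ) →
                       Σ n (λ v → G v * count n d (+ toℕ v)) ≡ Σ33 (λ y → G (residue n (d y)))
    Σ-weighted-count G = begin
      Σ n (λ v → G v * count n d (+ toℕ v))
        ≡⟨ Σ-cong n (λ v → *-distribˡ-Σ33 (G v) (λ y → [ n ∣ d y - + toℕ v ])) ⟩
      Σ n (λ v → Σ33 (λ y → G v * [ n ∣ d y - + toℕ v ]))
        ≡⟨ Σ33-comm n (λ y v → G v * [ n ∣ d y - + toℕ v ]) ⟨
      Σ33 (λ y → Σ n (λ v → G v * [ n ∣ d y - + toℕ v ]))
        ≡⟨ Σ33-cong (λ y → trans (Σ-cong n (λ v → *-indicator _ (G v))) (Σ-at-residue n (d y) G)) ⟩
      Σ33 (λ y → G (residue n (d y))) ∎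
      where open ≡-Reasoning

    zero-sum-average : ∀ {P} → AdditivelyClosed P → (G : Fin n → ℤ) →
      (∀ p q r → + toℕ p + + toℕ q + + toℕ r ≡ 0ℤ mod n → P (G p + G q + G r)) →
      P (+ 3 * Σ n (λ v → G v * count n d (+ toℕ v)))
    zero-sum-average {P} closed G G-zero-sum = subst P (sym tripled) (Σ33-closed closed P-triple)
      where
      Ĝ : Z33 → ℤ
      Ĝ y = G (residue n (d y))
      triple : Z33 → ℤ
      triple y = Ĝ y + Ĝ (x ⊕ y) + Ĝ (x ⊕ (x ⊕ y))
      P-triple : ∀ y → P (triple y)
      P-triple y = G-zero-sum _ _ _ (begin
        + toℕ (residue n (d y)) + + toℕ (residue n (d (x ⊕ y))) + + toℕ (residue n (d (x ⊕ (x ⊕ y))))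
          ≈⟨ mod-+-cong (mod-+-cong (residue⁻¹ y) (residue⁻¹ (x ⊕ y))) (residue⁻¹ (x ⊕ (x ⊕ y))) ⟩
        d y + d (x ⊕ y) + d (x ⊕ (x ⊕ y))
          ≡⟨ zero-sum y ⟩
        0ℤ ∎)
        where
        open mod-Reasoning n
        residue⁻¹ : ∀ y → + toℕ (residue n (d y)) ≡ d y mod n
        residue⁻¹ y = mod-sym (residue-correct n (d y))
      thrice : ∀ s → + 3 * s ≡ s + s + s
      thrice = solve-∀
      tripled : + 3 * Σ n (λ v → G v * count n d (+ toℕ v)) ≡ Σ33 triple
      tripled = begin
        + 3 * Σ n (λ v → G v * count n d (+ toℕ v))     ≡⟨ cong (_*_ (+ 3)) (Σ-weighted-count G) ⟩
        + 3 * Σ33 Ĝ                                     ≡⟨ thrice (Σ33 Ĝ) ⟩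
        Σ33 Ĝ + Σ33 Ĝ + Σ33 Ĝ
          ≡⟨ cong₂ (λ s s′ → Σ33 Ĝ + s + s′) (Σ33-translate x Ĝ)
                   (trans (Σ33-translate x (Ĝ ∘ (x ⊕_))) (Σ33-translate x Ĝ)) ⟨
        Σ33 Ĝ + Σ33 (λ y → Ĝ (x ⊕ y)) + Σ33 (λ y → Ĝ (x ⊕ (x ⊕ y)))
          ≡⟨ cong (_+ Σ33 (λ y → Ĝ (x ⊕ (x ⊕ y)))) (Σ33-distrib-+ Ĝ (Ĝ ∘ (x ⊕_))) ⟨
        Σ33 (λ y → Ĝ y + Ĝ (x ⊕ y)) + Σ33 (λ y → Ĝ (x ⊕ (x ⊕ y)))
          ≡⟨ Σ33-distrib-+ (λ y → Ĝ y + Ĝ (x ⊕ y)) (λ y → Ĝ (x ⊕ (x ⊕ y))) ⟨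
        Σ33 triple ∎
        where open ≡-Reasoning

  ∣-closed : ∀ n → AdditivelyClosed (+ n ∣_)
  ∣-closed n = record { closed-0 = divides 0ℤ refl ; closed-+ = ∣m∣n⇒∣m+n }

  nonpositive-closed : AdditivelyClosed (_≤ 0ℤ)
  nonpositive-closed = record { closed-0 = ℤₚ.≤-refl ; closed-+ = ℤₚ.+-mono-≤ }

  profile : Fin 5 → Fin 5 → Fin 5 → ℤ
  profile b c v = 1ℤ + + 11 * [ 5 ∣ + toℕ b - + toℕ v ] + + 11 * [ 5 ∣ + toℕ c - + toℕ v ]

  ±-weight : Fin 5 → Fin 5 → ℤ
  ±-weight b v = + 3 * ([ 5 ∣ + toℕ b - + toℕ v ] + [ 5 ∣ + toℕ b + + toℕ v ]) - + 2

  ±-weight-zero-sum : ∀ b → b ≢ zero → ∀ p q r → + toℕ p + + toℕ q + + toℕ r ≡ 0ℤ mod 5 →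
                      ±-weight b p + ±-weight b q + ±-weight b r ≤ 0ℤ
  ±-weight-zero-sum = from-yes
    (Finₚ.all? λ b → ¬? (b Finₚ.≟ zero) →-dec
     Finₚ.all? λ p → Finₚ.all? λ q → Finₚ.all? λ r →
     (+ toℕ p + + toℕ q + + toℕ r ≡? 0ℤ mod 5) →-dec
     (±-weight b p + ±-weight b q + ±-weight b r ℤ.≤? 0ℤ))

  profile-trivial : ∀ b c →
    + 5 ∣ + 3 * Σ 5 (λ v → + toℕ v * profile b c v) →
    (b ≢ zero → + 3 * Σ 5 (λ v → ±-weight b v * profile b c v) ≤ 0ℤ) →
    b ≡ zero × c ≡ zero
  profile-trivial = from-yes
    (Finₚ.all? λ b → Finₚ.all? λ c →
     (+ 5 ∣? (+ 3 * Σ 5 (λ v → + toℕ v * profile b c v))) →-dec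
     (¬? (b Finₚ.≟ zero) →-dec (+ 3 * Σ 5 (λ v → ±-weight b v * profile b c v) ℤ.≤? 0ℤ)) →-dec
     (b Finₚ.≟ zero ×-dec c Finₚ.≟ zero))

  count-profile-trivial : ∀ x d → ZeroSumAlong x d →
                          ∀ b c → (∀ v → count 5 d (+ toℕ v) ≡ profile b c v) → b ≡ zero × c ≡ zero
  count-profile-trivial x d zero-sum b c count≡profile = profile-trivial b c
    (subst (+ 5 ∣_) (weighted (λ v → + toℕ v))
      (zero-sum-average 5 x d zero-sum (∣-closed 5) (λ v → + toℕ v)
        (λ p q r → subst (+ 5 ∣_) (ℤₚ.+-identityʳ _) ∘ ∣-difference)))
    (λ b≢0 → subst (_≤ 0ℤ) (weighted (±-weight b))
      (zero-sum-average 5 x d zero-sum nonpositive-closed (±-weight b) (±-weight-zero-sum b b≢0)))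
    where
    weighted : ∀ G → + 3 * Σ 5 (λ v → G v * count 5 d (+ toℕ v)) ≡ + 3 * Σ 5 (λ v → G v * profile b c v)
    weighted G = cong (_*_ (+ 3)) (Σ-cong 5 (λ v → cong (_*_ (G v)) (count≡profile v)))

  -- The coefficients of φ(E_x)

  difference : ∀ {m} → (Z33 → Fin m) → Z33 → Z33 → ℤ
  difference f x y = + toℕ (f (x ⊕ y)) - + toℕ (f y)

  difference-zero-sum : ∀ {m} (f : Z33 → Fin m) x → ZeroSumAlong x (difference f x)
  difference-zero-sum f x y = begin
    difference f x y + difference f x (x ⊕ y) + difference f x (x ⊕ (x ⊕ y))
      ≡⟨ cong (λ z → difference f x y + difference f x (x ⊕ y) + (+ toℕ (f z) - + toℕ (f (x ⊕ (x ⊕ y)))))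
              (⊕-cube x y) ⟩
    (b - a) + (c - b) + (a - c)   ≡⟨ telescope a b c ⟩
    0ℤ ∎
    where
    open ≡-Reasoning
    a = + toℕ (f y)
    b = + toℕ (f (x ⊕ y))
    c = + toℕ (f (x ⊕ (x ⊕ y)))
    telescope : ∀ a b c → (b - a) + (c - b) + (a - c) ≡ 0ℤ
    telescope = solve-∀

  22+D₅-coefficient : ∀ t → (ι (+ 22) ⊞ D 5 5) t ≡ 1ℤ + + 11 * g^ 0ℤ t + + 11 * g^ 0ℤ t
  22+D₅-coefficient = from-yes (Finₚ.all? λ t →
    (ι (+ 22) ⊞ D 5 5) t ℤ.≟ 1ℤ + + 11 * g^ 0ℤ t + + 11 * g^ 0ℤ t)

  module _ (m' : ℕ) .{{_ : ℕ.NonZero (5 ℕ.* m')}} where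

    private
      m = 5 ℕ.* m'

    φ-E : ∀ f x t → φ m' (E m f x) t ≡ count 5 (difference f x) (+ (m' ℕ.* toℕ t))
    φ-E f x t = trans (φ-ΣG33 m' (λ y → g^ (difference f x y)) t)
                      (Σ33-cong λ y → φ-g^ m' (difference f x y) t)

    φ-D-⊠-g^ : ∀ d .{{_ : ℕ.NonZero d}} a t →
               φ m' (D m d ⊠ g^ a) t ≡ Σ d (λ l → [ 5 ∣ + (m ℕ./ d ℕ.* toℕ l) + a - + (m' ℕ.* toℕ t) ])
    φ-D-⊠-g^ d a t = begin
      φ m' (D m d ⊠ g^ a) t                                 ≡⟨ φ-cong m' (D-⊠-g^ d a) t ⟩
      φ m' (λ k → Σ d (λ l → g^ (exponent l) k)) t          ≡⟨ φ-Σ m' d (λ l → g^ (exponent l)) t ⟩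
      Σ d (λ l → φ m' (g^ (exponent l)) t)                  ≡⟨ Σ-cong d (λ l → φ-g^ m' (exponent l) t) ⟩
      Σ d (λ l → [ 5 ∣ exponent l - + (m' ℕ.* toℕ t) ])     ∎
      where
      open ≡-Reasoning
      exponent : Fin d → ℤ
      exponent l = + (m ℕ./ d ℕ.* toℕ l) + a

    φ-D₅-⊠-g^ : ∀ {r} → + m' * r ≡ 1ℤ mod 5 → ∀ a t → φ m' (D m 5 ⊠ g^ a) t ≡ 1ℤ
    φ-D₅-⊠-g^ {r} m'r≡1 a t = begin
      φ m' (D m 5 ⊠ g^ a) t
        ≡⟨ φ-D-⊠-g^ 5 a t ⟩
      Σ 5 (λ l → [ 5 ∣ + (m ℕ./ 5 ℕ.* toℕ l) + a - + (m' ℕ.* toℕ t) ])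
        ≡⟨ Σ-cong 5 (λ l → cong [ 5 ∣_] (regroup l)) ⟩
      Σ 5 (λ l → [ 5 ∣ + m' * + toℕ l + (a - + (m' ℕ.* toℕ t)) ])
        ≡⟨ Σ-unit (+ m') r m'r≡1 (a - + (m' ℕ.* toℕ t)) ⟩
      1ℤ ∎
      where
      open ≡-Reasoning
      m/5≡m' : m ℕ./ 5 ≡ m'
      m/5≡m' = trans (cong (ℕ._/ 5) (ℕₚ.*-comm 5 m')) (ℕ/.m*n/n≡m m' 5)
      regroup : ∀ l → + (m ℕ./ 5 ℕ.* toℕ l) + a - + (m' ℕ.* toℕ t)
                    ≡ + m' * + toℕ l + (a - + (m' ℕ.* toℕ t))
      regroup l rewrite m/5≡m' | ℤₚ.pos-* m' (toℕ l) = ℤₚ.+-assoc (+ m' * + toℕ l) a _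

    φ-D₁₁-⊠-g^ : 11 ℕ∣.∣ m → ∀ a t → φ m' (D m 11 ⊠ g^ a) t ≡ + 11 * [ 5 ∣ a - + (m' ℕ.* toℕ t) ]
    φ-D₁₁-⊠-g^ 11∣m a t = begin
      φ m' (D m 11 ⊠ g^ a) t
        ≡⟨ φ-D-⊠-g^ 11 a t ⟩
      Σ 11 (λ l → [ 5 ∣ + (m ℕ./ 11 ℕ.* toℕ l) + a - + (m' ℕ.* toℕ t) ])
        ≡⟨ Σ-cong 11 (λ l → [∣]-cong (mod-+-congʳ (- + (m' ℕ.* toℕ t)) (vanishes l))) ⟩
      Σ 11 (λ _ → [ 5 ∣ a - + (m' ℕ.* toℕ t) ])
        ≡⟨ Σ-const 11 _ ⟩
      + 11 * [ 5 ∣ a - + (m' ℕ.* toℕ t) ] ∎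
      where
      open ≡-Reasoning
      11∣m' : 11 ℕ∣.∣ m'
      11∣m' = coprime-divisor (from-yes (coprime? 11 5)) 11∣m
      5∣m/11 : 5 ℕ∣.∣ m ℕ./ 11
      5∣m/11 = subst (5 ℕ∣.∣_) (sym (ℕ/.*-/-assoc 5 11∣m')) (ℕ∣.m∣m*n (m' ℕ./ 11))
      vanishes : ∀ l → + (m ℕ./ 11 ℕ.* toℕ l) + a ≡ a mod 5
      vanishes l = mod-trans (mod-+-congʳ a (∣⇒≡0-mod 5∣m/11*l)) (≡⇒≡-mod (ℤₚ.+-identityˡ a))
        where
        5∣m/11*l : + 5 ∣ + (m ℕ./ 11 ℕ.* toℕ l)
        5∣m/11*l = ∣ᵤ⇒∣ (ℕ∣.∣m⇒∣m*n (toℕ l) 5∣m/11)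

    module _ {r : ℤ} (m'r≡1 : + m' * r ≡ 1ℤ mod 5) (11∣m : 11 ℕ∣.∣ m)
             (f : Z33 → Fin m) (x : Z33) (α β γ : ℤ)
             (E≈ : E m f x ≈ D m 5 ⊠ g^ α ⊞ D m 11 ⊠ (g^ β ⊞ g^ γ)) where

      private
        d = difference f x
        m't : Fin 5 → ℤ
        m't t = + (m' ℕ.* toℕ t)

      count-m't : ∀ t → count 5 d (m't t) ≡ 1ℤ + + 11 * [ 5 ∣ β - m't t ] + + 11 * [ 5 ∣ γ - m't t ]
      count-m't t = begin
        count 5 d (m't t)
          ≡⟨ φ-E f x t ⟨
        φ m' (E m f x) t
          ≡⟨ φ-cong m' E≈ t ⟩
        φ m' (D m 5 ⊠ g^ α ⊞ D m 11 ⊠ (g^ β ⊞ g^ γ)) t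
          ≡⟨ φ-⊞ m' (D m 5 ⊠ g^ α) (D m 11 ⊠ (g^ β ⊞ g^ γ)) t ⟩
        φ m' (D m 5 ⊠ g^ α) t + φ m' (D m 11 ⊠ (g^ β ⊞ g^ γ)) t
          ≡⟨ cong (_+_ (φ m' (D m 5 ⊠ g^ α) t))
                  (trans (φ-cong m' (⊠-distribˡ-⊞ (D m 11) (g^ β) (g^ γ)) t)
                         (φ-⊞ m' (D m 11 ⊠ g^ β) (D m 11 ⊠ g^ γ) t)) ⟩
        φ m' (D m 5 ⊠ g^ α) t + (φ m' (D m 11 ⊠ g^ β) t + φ m' (D m 11 ⊠ g^ γ) t)
          ≡⟨ cong₂ _+_ (φ-D₅-⊠-g^ m'r≡1 α t) (cong₂ _+_ (φ-D₁₁-⊠-g^ 11∣m β t) (φ-D₁₁-⊠-g^ 11∣m γ t)) ⟩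
        1ℤ + (+ 11 * [ 5 ∣ β - m't t ] + + 11 * [ 5 ∣ γ - m't t ])
          ≡⟨ ℤₚ.+-assoc 1ℤ (+ 11 * [ 5 ∣ β - m't t ]) (+ 11 * [ 5 ∣ γ - m't t ]) ⟨
        1ℤ + + 11 * [ 5 ∣ β - m't t ] + + 11 * [ 5 ∣ γ - m't t ] ∎
        where open ≡-Reasoning

      count-profile : ∀ v → count 5 d (+ toℕ v) ≡ profile (residue 5 β) (residue 5 γ) v
      count-profile v = begin
        count 5 d (+ toℕ v)
          ≡⟨ count-cong 5 d v≡m't ⟩
        count 5 d (m't t)
          ≡⟨ count-m't t ⟩
        1ℤ + + 11 * [ 5 ∣ β - m't t ] + + 11 * [ 5 ∣ γ - m't t ]
          ≡⟨ cong₂ (λ p q → 1ℤ + + 11 * p + + 11 * q) ([∣]-cong (reduce β)) ([∣]-cong (reduce γ)) ⟩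
        profile (residue 5 β) (residue 5 γ) v ∎
        where
        open ≡-Reasoning
        t : Fin 5
        t = proj₁ (unit-surjective (+ m') r m'r≡1 (+ toℕ v))
        v≡m't : + toℕ v ≡ m't t mod 5
        v≡m't = mod-sym (subst (λ z → z ≡ + toℕ v mod 5) (sym (ℤₚ.pos-* m' (toℕ t)))
                               (proj₂ (unit-surjective (+ m') r m'r≡1 (+ toℕ v))))
        reduce : ∀ a → a - m't t ≡ + toℕ (residue 5 a) - + toℕ v mod 5
        reduce a = mod-+-cong (residue-correct 5 a) (mod-neg-cong (mod-sym v≡m't))

      residues-vanish : residue 5 β ≡ zero × residue 5 γ ≡ zero
      residues-vanish = count-profile-trivial x d (difference-zero-sum f x) _ _ count-profile

      φ-E≈22+D₅ : φ m' (E m f x) ≈ ι (+ 22) ⊞ D 5 5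
      φ-E≈22+D₅ t = begin
        φ m' (E m f x) t
          ≡⟨ trans (φ-E f x t) (count-m't t) ⟩
        1ℤ + + 11 * [ 5 ∣ β - m't t ] + + 11 * [ 5 ∣ γ - m't t ]
          ≡⟨ cong₂ (λ p q → 1ℤ + + 11 * p + + 11 * q) (at-identity β (proj₁ residues-vanish))
                                                      (at-identity γ (proj₂ residues-vanish)) ⟩
        1ℤ + + 11 * g^ 0ℤ t + + 11 * g^ 0ℤ t
          ≡⟨ 22+D₅-coefficient t ⟨
        (ι (+ 22) ⊞ D 5 5) t ∎
        where
        open ≡-Reasoning
        at-identity : ∀ a → residue 5 a ≡ zero → [ 5 ∣ a - m't t ] ≡ g^ 0ℤ t
        at-identity a residue≡0 = trans ([∣]-cong a-m't≡m'[0-t]) ([∣]-unit (+ m') r m'r≡1 (0ℤ - + toℕ t))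
          where
          a≡0 : a ≡ 0ℤ mod 5
          a≡0 = subst (λ k → a ≡ + toℕ k mod 5) residue≡0 (residue-correct 5 a)
          a-m't≡m'[0-t] : a - m't t ≡ + m' * (0ℤ - + toℕ t) mod 5
          a-m't≡m'[0-t] = mod-trans (mod-+-congʳ (- m't t) a≡0)
            (≡⇒≡-mod (trans (cong (λ z → 0ℤ - z) (ℤₚ.pos-* m' (toℕ t))) (identity (+ m') (+ toℕ t))))
            where
            identity : ∀ u t → 0ℤ - u * t ≡ u * (0ℤ - t)
            identity = solve-∀

  22+D₅≈23+u±¹+u±² : ι (+ 22) ⊞ D 5 5 ≈ ι (+ 23) ⊞ g^ (+ 1) ⊞ g^ (- (+ 1)) ⊞ g^ (+ 2) ⊞ g^ (- (+ 2))
  22+D₅≈23+u±¹+u±² = from-yes (Finₚ.all? λ t →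
    (ι (+ 22) ⊞ D 5 5) t ℤ.≟ (ι (+ 23) ⊞ g^ (+ 1) ⊞ g^ (- (+ 1)) ⊞ g^ (+ 2) ⊞ g^ (- (+ 2))) t)

  5*-nonZero : ∀ {m'} → ¬ 5 ℕ∣.∣ m' → ℕ.NonZero (5 ℕ.* m')
  5*-nonZero {zero}   5∤0 = contradiction (5 ℕ∣.∣0) 5∤0
  5*-nonZero {suc m'} _   = _

open import Data.Nat using (ℕ; _*_)
open import Data.Nat.Divisibility using (_∣_)
open import Data.Integer using (ℤ; +_; -_)
open import Data.Fin using (Fin; toℕ; #_)
open import Data.Product using (_×_; ∃-syntax; _,_; proj₂)
open import Relation.Nullary using (¬_)
open import Relation.Binary.PropositionalEquality using (_≢_; trans)
open Lemmas using (5*-nonZero; inverse-mod-5; φ-E≈22+D₅; 22+D₅≈23+u±¹+u±²)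

-- The averaging over the triples (y, x+y, 2x+y) works for every x.
lemma3p5 : (m' : ℕ) → ¬ (5 ∣ m') → 11 ∣ (5 * m') →
    (f : Z33 → Fin (5 * m')) → (x : Z33) → x ≢ zero33 →
    (∃[ α ] ∃[ β ] ∃[ γ ]
      (E (5 * m') f x ≈ D (5 * m') 5 ⊠ g^ α ⊞ D (5 * m') 11 ⊠ (g^ β ⊞ g^ γ))) →
    (φ m' (E (5 * m') f x) ≈ ι (+ 22) ⊞ D 5 5)
    × (∃[ u₁ ] ∃[ u₂ ]
        (φ m' (E (5 * m') f x)
          ≈ ι (+ 23) ⊞ g^ (+ toℕ {5} u₁) ⊞ g^ (- (+ toℕ {5} u₁))
                     ⊞ g^ (+ toℕ {5} u₂) ⊞ g^ (- (+ toℕ {5} u₂))))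
lemma3p5 m' 5∤m' 11∣m f x _ (α , β , γ , E≈) =
  φE≈ , # 1 , # 2 , λ t → trans (φE≈ t) (22+D₅≈23+u±¹+u±² t)
  where
  φE≈ : φ m' (E (5 * m') f x) ≈ ι (+ 22) ⊞ D 5 5
  φE≈ = φ-E≈22+D₅ m' {{5*-nonZero 5∤m'}} (proj₂ (inverse-mod-5 m' 5∤m')) 11∣m f x α β γ E≈
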